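{- For every integer $m\ge1$, in every term of $Y\cdot P^m\cdot Y\in B^{\otimes(m+1)}$ the letters $Y$ and $Z$ alternate: between any two occurrences of $Y$ there is an occurrence of $Z$, and between any two occurrences of $Z$ there is an occurrence of $Y$.
   Context: Let $\mathcal M=\mathbb Z\langle y,n\rangle/(yn=ny=n,\ n^2=0,\ y^2=y)$. In the ring $\mathcal M\otimes\mathcal M$ (tensor over $\mathbb Z$, with $(a\otimes b)(c\otimes d)=ac\otimes bd$) put $X=y\otimes n+n\otimes y$, $Y=y\otimes y$, $Z=n\otimes n$, and let $B$ be the $\mathbb Z$-span of $X,Y,Z$: a commutative subring, free abelian with basis $X,Y,Z$, with $X^2=2Z$, $Y^2=Y$, $Z^2=0$, $XY=YX=X$, $XZ=ZX=0$, $YZ=ZY=Z$. For $r\ge1$, $B^{\otimes r}$ is free abelian with basis the words $w_1\otimes\cdots\otimes w_r$, $w_i\in\{X,Y,Z\}$; writing $u\in B^{\otimes r}$ uniquely as $\sum_w c_w w$, a term of $u$ is a word $w$ with $c_w\ne0$, and $c_w$ is its coefficient. The chaining product $B^{\otimes r}\times B^{\otimes s}\to B^{\otimes(r+s-1)}$ is the bilinear (associative) map $(a_1\otimes\cdots\otimes a_r)\cdot(b_1\otimes\cdots\otimes b_s)=a_1\otimes\cdots\otimes a_{r-1}\otimes(a_rb_1)\otimes b_2\otimes\cdots\otimes b_s$. Elements of $B$ are regarded as elements of $B^{\otimes1}$. Let $P=X\otimes Y+Y\otimes X\in B^{\otimes2}$ and let $P^m\in B^{\otimes(m+1)}$ be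 its $m$-fold chaining product. -}

module Defs where

open import Data.Nat using (ℕ; zero; suc; _+_; _<_)
open import Data.Integer using (ℤ; +_; _*_) renaming (_+_ to _+ℤ_)
open import Data.Fin using (Fin; toℕ)
open import Data.Vec using (Vec; []; _∷_; last; head; tail; lookup)
open import Data.Vec.Properties using (≡-dec)
open import Data.List using (List; []; _∷_; _++_; concatMap; map)
open import Data.Product using (_×_; _,_; ∃-syntax)
open import Relation.Binary.PropositionalEquality using (_≡_; refl)
open import Relation.Nullary using (Dec; yes; no)

data Letter : Set where
  X Y Z : Letter

_≟L_ : (a b : Letter) → Dec (a ≡ b)
X ≟L X = yes refl
X ≟L Y = no λ ()
X ≟L Z = no λ ()
Y ≟L X = no λ ()
Y ≟L Y = yes refl
Y ≟L Z = no λ ()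
Z ≟L X = no λ ()
Z ≟L Y = no λ ()
Z ≟L Z = yes refl

mulL : Letter → Letter → List (ℤ × Letter)
mulL X X = (+ 2 , Z) ∷ []
mulL X Y = (+ 1 , X) ∷ []
mulL X Z = []
mulL Y X = (+ 1 , X) ∷ []
mulL Y Y = (+ 1 , Y) ∷ []
mulL Y Z = (+ 1 , Z) ∷ []
mulL Z X = []
mulL Z Y = (+ 1 , Z) ∷ []
mulL Z Z = []

Word : ℕ → Set
Word n = Vec Letter (suc n)

-- An element of B^{⊗(n+1)}, as a formal ℤ-linear combination of words
-- (a finite list of (coefficient, word) pairs; repetitions are summed).
Elem : ℕ → Set
Elem n = List (ℤ × Word n)

coeff : ∀ {n} → Elem n → Word n → ℤ
coeff [] w = + 0
coeff ((c , v) ∷ u) w with ≡-dec _≟L_ v w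
... | yes _ = c +ℤ coeff u w
... | no _  = coeff u w

glue : ∀ {a b} → Vec Letter (suc a) → Letter → Vec Letter b → Vec Letter (suc (a + b))
glue (x ∷ [])     l ys = l ∷ ys
glue (x ∷ y ∷ xs) l ys = x ∷ glue (y ∷ xs) l ys

chainW : ∀ {a b} → Word a → Word b → Elem (a + b)
chainW u v = map (λ { (e , l) → (e , glue u l (tail v)) }) (mulL (last u) (head v))

_·_ : ∀ {a b} → Elem a → Elem b → Elem (a + b)
u · v = concatMap (λ { (c , w) →
          concatMap (λ { (d , w') →
            map (λ { (e , x) → (c * d * e , x) }) (chainW w w') }) v }) u

infixl 7 _·_

Yₑ : Elem 0
Yₑ = (+ 1 , Y ∷ []) ∷ []

P : Elem 1
P = (+ 1 , X ∷ Y ∷ []) ∷ (+ 1 , Y ∷ X ∷ []) ∷ []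

-- P^m ∈ B^{⊗(m+1)}: the m-fold chaining product (P^0 := Y, the unit of B;
-- only m ≥ 1 is used in the statement).
Ppow : (m : ℕ) → Elem m
Ppow zero    = Yₑ
Ppow (suc m) = P · Ppow m

Alternates : ∀ {n} → Vec Letter n → Set
Alternates w =
  (∀ i j → toℕ i < toℕ j → lookup w i ≡ Y → lookup w j ≡ Y →
     ∃[ k ] (toℕ i < toℕ k × toℕ k < toℕ j × lookup w k ≡ Z)) ×
  (∀ i j → toℕ i < toℕ j → lookup w i ≡ Z → lookup w j ≡ Z →
     ∃[ k ] (toℕ i < toℕ k × toℕ k < toℕ j × lookup w k ≡ Y))

-- Every term of P^m satisfies the invariant "its Y/Z-letters alternate starting with Y":
-- chaining X⊗Y in front prepends an X, and chaining Y⊗X in front prepends a Y and turns a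
-- leading X into Z (X² = 2Z) or a leading Y into X, while a leading Z cannot occur.
-- Since Y is the unit of B, chaining Y on either side leaves every word unchanged.
module Submission where

open import Defs
open import Data.Nat using (ℕ; zero; suc; _≤_; _<_; _+_; z≤n; s≤s)
open import Data.Integer using (+_)
open import Data.Fin using (Fin; toℕ; zero; suc)
open import Data.Vec using (Vec; []; _∷_; last; lookup)
open import Data.Vec.Properties using (≡-dec)
open import Data.List using ([]; _∷_)
import Data.List.Relation.Unary.All as All
open All using (All; []; _∷_)
open import Data.List.Relation.Unary.All.Properties using (concat⁺; map⁺)
open import Data.Product using (_×_; _,_; ∃-syntax; proj₂; map; map₁)
open import Data.Empty using (⊥-elim)
open import Function using (_∘_)
open import Relation.Binary.PropositionalEquality using (_≢_; _≡_; refl; subst; sym)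
open import Relation.Nullary using (yes; no)

private
  variable
    a b n : ℕ
    c l : Letter
    w : Vec Letter n

swapYZ : Letter → Letter
swapYZ X = X
swapYZ Y = Z
swapYZ Z = Y

data YorZ : Letter → Set where
  isY : YorZ Y
  isZ : YorZ Z

data AlternatesFrom (l : Letter) : Vec Letter n → Set where
  []     : AlternatesFrom l []
  skip   : AlternatesFrom l w → AlternatesFrom l (X ∷ w)
  switch : AlternatesFrom (swapYZ l) w → AlternatesFrom l (l ∷ w)

precededBy : YorZ l → AlternatesFrom l w → (j : Fin n) → lookup w j ≡ swapYZ l →
             ∃[ k ] (toℕ k < toℕ j × lookup w k ≡ l)
precededBy isY (skip _)   zero    ()
precededBy isZ (skip _)   zero    ()
precededBy yz  (skip p)   (suc j) e = map suc (map₁ s≤s) (precededBy yz p j e)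
precededBy isY (switch _) zero    ()
precededBy isZ (switch _) zero    ()
precededBy _   (switch _) (suc j) _ = zero , s≤s z≤n , refl

separated : YorZ c → AlternatesFrom l w → (i j : Fin n) → toℕ i < toℕ j →
            lookup w i ≡ c → lookup w j ≡ c →
            ∃[ k ] (toℕ i < toℕ k × toℕ k < toℕ j × lookup w k ≡ swapYZ c)
separated isY (skip _)   zero    _       _         ()
separated isZ (skip _)   zero    _       _         ()
separated isY (switch p) zero    (suc j) _         refl e =
  map suc (λ (k<j , e′) → s≤s z≤n , s≤s k<j , e′) (precededBy isZ p j e)
separated isZ (switch p) zero    (suc j) _         refl e =
  map suc (λ (k<j , e′) → s≤s z≤n , s≤s k<j , e′) (precededBy isY p j e)
separated yz  (skip p)   (suc i) (suc j) (s≤s i<j) eᵢ eⱼ =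
  map suc (map s≤s (map₁ s≤s)) (separated yz p i j i<j eᵢ eⱼ)
separated yz  (switch p) (suc i) (suc j) (s≤s i<j) eᵢ eⱼ =
  map suc (map s≤s (map₁ s≤s)) (separated yz p i j i<j eᵢ eⱼ)

alternatesFrom⇒Alternates : AlternatesFrom l w → Alternates w
alternatesFrom⇒Alternates p = separated isY p , separated isZ p

AllWords : (Word n → Set) → Elem n → Set
AllWords C = All (C ∘ proj₂)

allWords-coeff≢0 : {C : Word n → Set} (u : Elem n) → AllWords C u → coeff u w ≢ + 0 → C w
allWords-coeff≢0           []            []       ≢0 = ⊥-elim (≢0 refl)
allWords-coeff≢0 {w = w} ((_ , v) ∷ u) (cv ∷ cu) ≢0 with ≡-dec _≟L_ v w
... | yes refl = cv
... | no _     = allWords-coeff≢0 u cu ≢0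

allWords-· : {A : Word a → Set} {B : Word b → Set} {C : Word (a + b) → Set}
             {u : Elem a} {v : Elem b} → AllWords A u → AllWords B v →
             (∀ {w w′} → A w → B w′ → AllWords C (chainW w w′)) → AllWords C (u · v)
allWords-· Au Bv chain =
  concat⁺ (map⁺ (All.map (λ Aw → concat⁺ (map⁺ (All.map (λ Bw′ → map⁺ (chain Aw Bw′)) Bv))) Au))

chainW-identityˡ : (w : Word b) → chainW (Y ∷ []) w ≡ (+ 1 , w) ∷ []
chainW-identityˡ (X ∷ _) = refl
chainW-identityˡ (Y ∷ _) = refl
chainW-identityˡ (Z ∷ _) = refl

chainW-identityʳ : (w : Word a) → chainW w (Y ∷ []) ≡ (+ 1 , glue w (last w) []) ∷ []
chainW-identityʳ w with last w
... | X = refl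
... | Y = refl
... | Z = refl

allWords-Yₑ· : {C : Word b → Set} {u : Elem b} → AllWords C u → AllWords C (Yₑ · u)
allWords-Yₑ· {C = C} Cu = allWords-· {A = _≡ Y ∷ []} {u = Yₑ} (refl ∷ []) Cu
  λ { {w′ = w′} refl Cw′ → subst (AllWords C) (sym (chainW-identityˡ w′)) (Cw′ ∷ []) }

alternatesFrom-glue-last : {w : Word a} → AlternatesFrom l w →
                           AlternatesFrom l (glue w (last w) [])
alternatesFrom-glue-last {w = _ ∷ []}    p          = p
alternatesFrom-glue-last {w = _ ∷ _ ∷ _} (skip p)   = skip (alternatesFrom-glue-last p)
alternatesFrom-glue-last {w = _ ∷ _ ∷ _} (switch p) = switch (alternatesFrom-glue-last p)

alternatesFrom-·Yₑ : {u : Elem a} → AllWords (AlternatesFrom l) u →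
                     AllWords (AlternatesFrom l) (u · Yₑ)
alternatesFrom-·Yₑ {l = l} Au = allWords-· {B = _≡ Y ∷ []} {v = Yₑ} Au (refl ∷ [])
  λ { {w} p refl → subst (AllWords (AlternatesFrom l)) (sym (chainW-identityʳ w))
                         (alternatesFrom-glue-last p ∷ []) }

PreservesAlternation : Word a → Set
PreservesAlternation w =
  ∀ {b} {w′ : Word b} → AlternatesFrom Y w′ → AllWords (AlternatesFrom Y) (chainW w w′)

XY-preservesAlternation : PreservesAlternation (X ∷ Y ∷ [])
XY-preservesAlternation (skip p)   = skip (skip p) ∷ []
XY-preservesAlternation (switch p) = skip (switch p) ∷ []

YX-preservesAlternation : PreservesAlternation (Y ∷ X ∷ [])
YX-preservesAlternation (skip p)   = switch (switch p) ∷ []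
YX-preservesAlternation (switch p) = switch (skip p) ∷ []

alternatesFrom-Ppow : (m : ℕ) → AllWords (AlternatesFrom Y) (Ppow m)
alternatesFrom-Ppow zero    = switch [] ∷ []
alternatesFrom-Ppow (suc m) =
  allWords-· {A = PreservesAlternation} {u = P}
             (XY-preservesAlternation ∷ YX-preservesAlternation ∷ [])
             (alternatesFrom-Ppow m) (λ preserves p → preserves p)

lemma5p7 : (m : ℕ) → 1 ≤ m → (w : Word (m + 0)) →
    coeff (Yₑ · Ppow m · Yₑ) w ≢ + 0 → Alternates w
lemma5p7 m _ w coeff≢0 =
  alternatesFrom⇒Alternates
    (allWords-coeff≢0 (Yₑ · Ppow m · Yₑ)
      (alternatesFrom-·Yₑ (allWords-Yₑ· (alternatesFrom-Ppow m))) coeff≢0)
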